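{- For every positive integer $n$, the set $B_n(132,213)$ is in bijection with the set of left factors of Dyck paths with $n-1$ steps. Consequently, for every $n\ge 0$, $|B_{n+1}(132,213)|=\binom{n}{\lfloor n/2\rfloor}$.
   Context: A permutation $\sigma\in S_n$ is written as $\sigma(1)\cdots\sigma(n)$. An index $i\in[n-1]$ is an ascent if $\sigma(i)<\sigma(i+1)$ and a descent if $\sigma(i)>\sigma(i+1)$. A ballot permutation is a permutation such that every prefix $\sigma(1)\cdots\sigma(p)$ has at least as many ascents as descents. $\sigma$ contains a pattern $\pi\in S_k$ if some subsequence $\sigma(c_1)\cdots\sigma(c_k)$ with $c_1<\dots<c_k$ is order-isomorphic to $\pi$, and avoids $\pi$ otherwise. $B_n(\pi_1,\dots,\pi_m)$ denotes the set of ballot permutations of length $n$ avoiding all of $\pi_1,\dots,\pi_m$. A left factor of a Dyck path with $m$ steps is a word of length $m$ in the letters $U$ (up step) and $D$ (down step) such that every prefix contains at least as many $U$'s as $D$'s (equivalently, a length-$m$ prefix of some Dyck path). -}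

module Defs where

open import Data.Nat using (ℕ; zero; suc; _+_; _≤_; _<_)
open import Data.Nat.Properties using (_<?_; <-trans; n<1+n)
open import Data.Bool using (if_then_else_)
open import Relation.Nullary.Decidable using (⌊_⌋)
open import Data.Fin using (Fin; fromℕ<)
import Data.Fin as F
open import Data.Product using (Σ; _×_; proj₁; _,_)
open import Data.Vec using (Vec; lookup)
open import Data.List using (List; []; _∷_; _++_; length)
open import Function.Definitions using (Injective)
open import Relation.Nullary using (¬_; yes; no)
open import Relation.Binary.PropositionalEquality using (_≡_)

-- A permutation σ ∈ S_n in one-line notation σ(1)⋯σ(n), 0-indexed:
-- a vector of n values in Fin n that are pairwise distinct.
Perm : ℕ → Set
Perm n = Σ (Vec (Fin n) n) λ v → Injective _≡_ _≡_ (lookup v)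

app : ∀ {n} → Perm n → Fin n → Fin n
app σ = lookup (proj₁ σ)

module _ {n : ℕ} (σ : Perm n) where
  ascAt : ℕ → ℕ
  ascAt i with suc i <? n
  ... | no _ = 0
  ... | yes h = if ⌊ app σ (fromℕ< (<-trans (n<1+n i) h)) F.<? app σ (fromℕ< h) ⌋ then 1 else 0

  desAt : ℕ → ℕ
  desAt i with suc i <? n
  ... | no _ = 0
  ... | yes h = if ⌊ app σ (fromℕ< h) F.<? app σ (fromℕ< (<-trans (n<1+n i) h)) ⌋ then 1 else 0

  -- number of ascents / descents of the prefix σ(1)⋯σ(p),
  -- i.e. over (0-indexed) positions i with i + 1 < p
  ascPrefix : ℕ → ℕ
  ascPrefix zero = 0
  ascPrefix (suc zero) = 0
  ascPrefix (suc (suc i)) = ascAt i + ascPrefix (suc i)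

  desPrefix : ℕ → ℕ
  desPrefix zero = 0
  desPrefix (suc zero) = 0
  desPrefix (suc (suc i)) = desAt i + desPrefix (suc i)

IsBallot : ∀ {n} → Perm n → Set
IsBallot {n} σ = ∀ p → p ≤ n → desPrefix σ p ≤ ascPrefix σ p

Contains : ∀ {n k} → Perm n → Perm k → Set
Contains {n} {k} σ π =
  Σ (Fin k → Fin n) λ c →
    (∀ i j → i F.< j → c i F.< c j) ×
    (∀ i j → (app σ (c i) F.< app σ (c j) → app π i F.< app π j)
           × (app π i F.< app π j → app σ (c i) F.< app σ (c j)))

Avoids : ∀ {n k} → Perm n → Perm k → Set
Avoids σ π = ¬ Contains σ π

p132 : Perm 3
p132 = (F.zero Vec.∷ F.suc (F.suc F.zero) Vec.∷ F.suc F.zero Vec.∷ Vec.[]) , inj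
  where
  import Data.Vec as Vec
  open import Relation.Binary.PropositionalEquality using (refl)
  inj : Injective _≡_ _≡_ (lookup (F.zero Vec.∷ F.suc (F.suc F.zero) Vec.∷ F.suc F.zero Vec.∷ Vec.[]))
  inj {F.zero} {F.zero} _ = refl
  inj {F.suc F.zero} {F.suc F.zero} _ = refl
  inj {F.suc (F.suc F.zero)} {F.suc (F.suc F.zero)} _ = refl
  inj {F.zero} {F.suc F.zero} ()
  inj {F.zero} {F.suc (F.suc F.zero)} ()
  inj {F.suc F.zero} {F.zero} ()
  inj {F.suc F.zero} {F.suc (F.suc F.zero)} ()
  inj {F.suc (F.suc F.zero)} {F.zero} ()
  inj {F.suc (F.suc F.zero)} {F.suc F.zero} ()

p213 : Perm 3
p213 = (F.suc F.zero Vec.∷ F.zero Vec.∷ F.suc (F.suc F.zero) Vec.∷ Vec.[]) , inj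
  where
  import Data.Vec as Vec
  open import Relation.Binary.PropositionalEquality using (refl)
  inj : Injective _≡_ _≡_ (lookup (F.suc F.zero Vec.∷ F.zero Vec.∷ F.suc (F.suc F.zero) Vec.∷ Vec.[]))
  inj {F.zero} {F.zero} _ = refl
  inj {F.suc F.zero} {F.suc F.zero} _ = refl
  inj {F.suc (F.suc F.zero)} {F.suc (F.suc F.zero)} _ = refl
  inj {F.zero} {F.suc F.zero} ()
  inj {F.zero} {F.suc (F.suc F.zero)} ()
  inj {F.suc F.zero} {F.zero} ()
  inj {F.suc F.zero} {F.suc (F.suc F.zero)} ()
  inj {F.suc (F.suc F.zero)} {F.zero} ()
  inj {F.suc (F.suc F.zero)} {F.suc F.zero} ()

InB-132-213 : (n : ℕ) → Vec (Fin n) n → Set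
InB-132-213 n v = Σ (Injective _≡_ _≡_ (lookup v)) λ inj →
  IsBallot (v , inj) × Avoids (v , inj) p132 × Avoids (v , inj) p213

B-132-213 : ℕ → Set
B-132-213 n = Σ (Vec (Fin n) n) (InB-132-213 n)

data Step : Set where
  U D : Step

countU countD : List Step → ℕ
countU [] = 0
countU (U ∷ w) = suc (countU w)
countU (D ∷ w) = countU w
countD [] = 0
countD (U ∷ w) = countD w
countD (D ∷ w) = suc (countD w)

IsLeftFactor : List Step → Set
IsLeftFactor w = ∀ u v → w ≡ u ++ v → countD u ≤ countU u

InLeftFactor : ℕ → List Step → Set
InLeftFactor m w = length w ≡ m × IsLeftFactor w

LeftFactor : ℕ → Set
LeftFactor m = Σ (List Step) (InLeftFactor m)

-- A bijection between sets given as subtypes Σ X P, Σ Y Q, where elements are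
-- identified by their underlying object (proofs of the defining property are
-- ignored, as befits subsets): mutually inverse maps on underlying objects.
record SubsetBij {X Y : Set} (P : X → Set) (Q : Y → Set) : Set where
  field
    to   : Σ X P → Σ Y Q
    from : Σ Y Q → Σ X P
    from∘to : ∀ a → proj₁ (from (to a)) ≡ proj₁ a
    to∘from : ∀ b → proj₁ (to (from b)) ≡ proj₁ b

-- An entry of a permutation avoiding 132 and 213 is smaller than a later entry
-- only if every step in between is an ascent.  Hence such a permutation is
-- determined by its ascent/descent word (two of them with the same word are
-- order isomorphic), and every word is realised: reading it from the right, a
-- D puts a new largest entry in front, a U puts in front a copy of the current
-- first entry and shifts the entries at least as large up by one.  Prefix
-- ascent and descent counts of the permutation are U and D counts of the word,
-- so ballot permutations correspond to left factors of Dyck paths.  Left factors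
-- of length m starting at height h are counted by the sum of the binomial
-- coefficients m C i for ⌊(m ∸ h)/2⌋ ≤ i ≤ ⌊(h + m)/2⌋, which for h = 0 is
-- the central binomial coefficient.
module Submission where

open import Defs
open import Data.Nat using (ℕ; suc; _/_)
open import Data.Nat.Combinatorics using (_C_)
open import Data.Fin using (Fin)
open import Data.Unit using (⊤)
open import Data.Product using (_×_)

open import Data.Bool using (if_then_else_)
open import Data.Empty using (⊥)
import Data.Fin as F
open import Data.Fin using (toℕ; fromℕ<)
import Data.Fin.Properties as FP
open import Data.List using (List; []; _∷_; _++_; length; applyUpTo)
open import Data.List.Properties using (∷-injectiveˡ; ∷-injectiveʳ; length-++; length-applyUpTo; applyUpTo-∷ʳ)
open import Data.Nat using (zero; _+_; _∸_; _≤_; _<_; z≤n; s≤s; s≤s⁻¹; _<?_; ⌊_/2⌋)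
open import Data.Nat.Combinatorics using (nCk+nC[k+1]≡[n+1]C[k+1])
open import Data.Nat.DivMod using (m/n≡1+[m∸n]/n)
open import Data.Nat.Properties
open import Algebra.Properties.CommutativeSemigroup +-commutativeSemigroup using (interchange)
open import Data.Product using (∃; _,_; proj₁; proj₂)
open import Data.Sum using (inj₁; inj₂; [_,_]′)
open import Data.Unit using (tt)
open import Data.Vec using (Vec; lookup; tabulate)
open import Data.Vec.Properties using (lookup∘tabulate; tabulate∘lookup; tabulate-cong)
open import Function using (_∘_)
open import Function.Definitions using (Injective)
open import Relation.Binary.Definitions using (tri<; tri≈; tri>)
open import Relation.Binary.PropositionalEquality
open import Relation.Nullary using (¬_; Dec; yes; no; contradiction)
open import Relation.Nullary.Decidable using (⌊_⌋)

open ≡-Reasoning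

-- Permutations of [0, N) as functions on ℕ

EqOn : (ℕ → ℕ) → (ℕ → ℕ) → ℕ → Set
EqOn s t N = ∀ {k} → k < N → s k ≡ t k

InjectiveOn : (ℕ → ℕ) → ℕ → Set
InjectiveOn s N = ∀ {i j} → i < N → j < N → s i ≡ s j → i ≡ j

record PermutationOn (s : ℕ → ℕ) (N : ℕ) : Set where
  field
    injective : InjectiveOn s N
    into      : ∀ {i} → i < N → s i < N
    onto      : ∀ {v} → v < N → ∃ λ i → i < N × s i ≡ v

AscendsOn : (ℕ → ℕ) → ℕ → ℕ → Set
AscendsOn s a b = ∀ k → a ≤ k → k < b → s k < s (suc k)

RisesAscend : (ℕ → ℕ) → ℕ → Set
RisesAscend s N = ∀ a b → a < b → b < N → s a < s b → AscendsOn s a b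

AscentsIncluded : (ℕ → ℕ) → (ℕ → ℕ) → ℕ → Set
AscentsIncluded s t N = ∀ k → suc k < N → s k < s (suc k) → t k < t (suc k)

Occurs132 : (ℕ → ℕ) → ℕ → Set
Occurs132 s N = ∃ λ a → ∃ λ b → ∃ λ c → a < b × b < c × c < N × s a < s c × s c < s b

Occurs213 : (ℕ → ℕ) → ℕ → Set
Occurs213 s N = ∃ λ a → ∃ λ b → ∃ λ c → a < b × b < c × c < N × s b < s a × s a < s c

ascendsOn⇒< : ∀ s {a b} → AscendsOn s a b → a < b → s a < s b
ascendsOn⇒< s {a} {suc b} asc a<1+b with m≤n⇒m<n∨m≡n (s≤s⁻¹ a<1+b)
... | inj₁ a<b =
  <-trans (ascendsOn⇒< s (λ k a≤k k<b → asc k a≤k (m<n⇒m<1+n k<b)) a<b) (asc b (<⇒≤ a<b) ≤-refl)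
... | inj₂ refl = asc a ≤-refl ≤-refl

ascendsOn-transport : ∀ {s t N} {a b} → AscentsIncluded s t N → b < N → AscendsOn s a b → AscendsOn t a b
ascendsOn-transport s⊆t b<N asc k a≤k k<b = s⊆t k (≤-<-trans k<b b<N) (asc k a≤k k<b)

risesAscend⇒¬132 : ∀ s {N} → RisesAscend s N → ¬ Occurs132 s N
risesAscend⇒¬132 s rises (a , b , c , a<b , b<c , c<N , sa<sc , sc<sb) =
  <-asym sc<sb (ascendsOn⇒< s (λ k b≤k k<c → ascends k (≤-trans (<⇒≤ a<b) b≤k) k<c) b<c)
  where ascends = rises a c (<-trans a<b b<c) c<N sa<sc

risesAscend⇒¬213 : ∀ s {N} → RisesAscend s N → ¬ Occurs213 s N
risesAscend⇒¬213 s rises (a , b , c , a<b , b<c , c<N , sb<sa , sa<sc) =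
  <-asym sb<sa (ascendsOn⇒< s (λ k a≤k k<b → ascends k a≤k (<-trans k<b b<c)) a<b)
  where ascends = rises a c (<-trans a<b b<c) c<N sa<sc

-- s k < s b spreads from k = a up to b, since a failure at k + 1 gives a 132
-- at k, k + 1, b; and then a descent at k would give a 213 at k, k + 1, b.
avoiding⇒risesAscend : ∀ s {N} → InjectiveOn s N → ¬ Occurs132 s N → ¬ Occurs213 s N → RisesAscend s N
avoiding⇒risesAscend s {N} inj no132 no213 a b a<b b<N sa<sb k a≤k k<b =
  ascentBeforeEnd k k<b
    (subst (λ i → s i < s b) (m∸n+n≡m a≤k) (belowEnd (k ∸ a) (subst (_< b) (sym (m∸n+n≡m a≤k)) k<b)))
  where
  ascentBeforeEnd : ∀ k → k < b → s k < s b → s k < s (suc k)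
  ascentBeforeEnd k k<b sk<sb with <-cmp (s k) (s (suc k)) | m≤n⇒m<n∨m≡n k<b
  ... | tri< sk<s1+k _ _ | _ = sk<s1+k
  ... | tri≈ _ sk≡s1+k _ | _ = contradiction (inj (<-trans k<b b<N) (≤-<-trans k<b b<N) sk≡s1+k) (<⇒≢ (n<1+n k))
  ... | tri> _ _ s1+k<sk | inj₁ 1+k<b = contradiction (k , suc k , b , n<1+n k , 1+k<b , b<N , s1+k<sk , sk<sb) no213
  ... | tri> _ _ s1+k<sk | inj₂ refl = contradiction sk<sb (<-asym s1+k<sk)

  nextBelowEnd : ∀ k → suc k < b → s k < s b → s (suc k) < s b
  nextBelowEnd k 1+k<b sk<sb with <-cmp (s (suc k)) (s b)
  ... | tri< s1+k<sb _ _ = s1+k<sb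
  ... | tri≈ _ s1+k≡sb _ = contradiction (inj (<-trans 1+k<b b<N) b<N s1+k≡sb) (<⇒≢ 1+k<b)
  ... | tri> _ _ sb<s1+k = contradiction (k , suc k , b , n<1+n k , 1+k<b , b<N , sk<sb , sb<s1+k) no132

  belowEnd : ∀ d → d + a < b → s (d + a) < s b
  belowEnd zero _ = sa<sb
  belowEnd (suc d) 1+d+a<b = nextBelowEnd (d + a) 1+d+a<b (belowEnd d (<-trans (n<1+n (d + a)) 1+d+a<b))

sameAscents⇒<-preserved : ∀ s t {N} → InjectiveOn t N → RisesAscend s N → RisesAscend t N →
                          AscentsIncluded s t N → AscentsIncluded t s N →
                          ∀ {i j} → i < N → j < N → s i < s j → t i < t j
sameAscents⇒<-preserved s t injectiveT risesS risesT s⊆t t⊆s {i} {j} i<N j<N si<sj with <-cmp i j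
... | tri< i<j _ _ = ascendsOn⇒< t (ascendsOn-transport {s} {t} s⊆t j<N (risesS i j i<j j<N si<sj)) i<j
... | tri≈ _ refl _ = contradiction si<sj (<-irrefl refl)
... | tri> _ _ j<i with <-cmp (t i) (t j)
...   | tri< ti<tj _ _ = ti<tj
...   | tri≈ _ ti≡tj _ = contradiction (injectiveT i<N j<N ti≡tj) (>⇒≢ j<i)
...   | tri> _ _ tj<ti =
  contradiction (ascendsOn⇒< s (ascendsOn-transport {t} {s} t⊆s i<N (risesT j i j<i i<N tj<ti)) j<i) (<-asym si<sj)

<-preserved⇒≤ : ∀ {s t : ℕ → ℕ} {N} → PermutationOn s N →
                (∀ {i j} → i < N → j < N → s i < s j → t i < t j) → ∀ {i} → i < N → s i ≤ t i
<-preserved⇒≤ {s} {t} {N} perm preserved {i} i<N = go (s i) i<N refl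
  where
  open PermutationOn perm
  go : ∀ v {i} → i < N → s i ≡ v → v ≤ t i
  go zero _ _ = z≤n
  go (suc v) i<N si≡1+v with onto (<-trans (subst (v <_) (sym si≡1+v) (n<1+n v)) (into i<N))
  ... | j , j<N , sj≡v =
    ≤-<-trans (go v j<N sj≡v) (preserved j<N i<N (subst₂ _<_ (sym sj≡v) (sym si≡1+v) (n<1+n v)))

risesAscend-unique : ∀ {s t N} → PermutationOn s N → PermutationOn t N → RisesAscend s N → RisesAscend t N →
                     AscentsIncluded s t N → AscentsIncluded t s N → EqOn s t N
risesAscend-unique {s} {t} permS permT risesS risesT s⊆t t⊆s k<N = ≤-antisym
  (<-preserved⇒≤ {t = t} permS (sameAscents⇒<-preserved s t (PermutationOn.injective permT) risesS risesT s⊆t t⊆s) k<N)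
  (<-preserved⇒≤ {t = s} permT (sameAscents⇒<-preserved t s (PermutationOn.injective permS) risesT risesS t⊆s s⊆t) k<N)

risesAscend-cong : ∀ {s t N} → EqOn s t N → RisesAscend s N → RisesAscend t N
risesAscend-cong s≗t rises a b a<b b<N ta<tb k a≤k k<b =
  subst₂ _<_ (s≗t k<N) (s≗t (≤-<-trans k<b b<N))
    (rises a b a<b b<N (subst₂ _<_ (sym (s≗t (<-trans a<b b<N))) (sym (s≗t b<N)) ta<tb) k a≤k k<b)
  where k<N = <-trans k<b b<N

ascentStep : ℕ → ℕ → Step
ascentStep x y with x <? y
... | yes _ = U
... | no _ = D

stepAt : (ℕ → ℕ) → ℕ → Step
stepAt s k = ascentStep (s k) (s (suc k))

ascentWord : (ℕ → ℕ) → ℕ → List Step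
ascentWord s n = applyUpTo (stepAt s) n

ascentStep-U : ∀ {x y} → x < y → ascentStep x y ≡ U
ascentStep-U {x} {y} x<y with x <? y
... | yes _ = refl
... | no x≮y = contradiction x<y x≮y

ascentStep-D : ∀ {x y} → ¬ x < y → ascentStep x y ≡ D
ascentStep-D {x} {y} x≮y with x <? y
... | yes x<y = contradiction x<y x≮y
... | no _ = refl

ascentStep≡U⇒< : ∀ {x y} → ascentStep x y ≡ U → x < y
ascentStep≡U⇒< {x} {y} eq with x <? y
... | yes x<y = x<y

applyUpTo-cong : ∀ {A : Set} {f g : ℕ → A} n → (∀ {k} → k < n → f k ≡ g k) →
                 applyUpTo f n ≡ applyUpTo g n
applyUpTo-cong zero _ = refl
applyUpTo-cong (suc n) f≗g = cong₂ _∷_ (f≗g (s≤s z≤n)) (applyUpTo-cong n (λ k<n → f≗g (s≤s k<n)))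

applyUpTo-cong⁻¹ : ∀ {A : Set} {f g : ℕ → A} n → applyUpTo f n ≡ applyUpTo g n →
                   ∀ {k} → k < n → f k ≡ g k
applyUpTo-cong⁻¹ (suc n) eq {zero} _ = ∷-injectiveˡ eq
applyUpTo-cong⁻¹ (suc n) eq {suc k} 1+k<1+n = applyUpTo-cong⁻¹ n (∷-injectiveʳ eq) (s≤s⁻¹ 1+k<1+n)

applyUpTo-+ : ∀ {A : Set} (f : ℕ → A) q r → applyUpTo f (q + r) ≡ applyUpTo f q ++ applyUpTo (λ k → f (q + k)) r
applyUpTo-+ f zero r = refl
applyUpTo-+ f (suc q) r = cong (f 0 ∷_) (applyUpTo-+ (λ k → f (suc k)) q r)

applyUpTo-prefix : ∀ {A : Set} (f : ℕ → A) n u v → applyUpTo f n ≡ u ++ v → u ≡ applyUpTo f (length u)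
applyUpTo-prefix f n [] v eq = refl
applyUpTo-prefix f (suc n) (x ∷ u) v eq =
  cong₂ _∷_ (sym (∷-injectiveˡ eq)) (applyUpTo-prefix (λ k → f (suc k)) n u v (∷-injectiveʳ eq))

ascentWord-cong : ∀ {s t n} → EqOn s t (suc n) → ascentWord s n ≡ ascentWord t n
ascentWord-cong {n = n} s≗t =
  applyUpTo-cong n (λ k<n → cong₂ ascentStep (s≗t (m<n⇒m<1+n k<n)) (s≗t (s≤s k<n)))

sameAscentWord⇒ascentsIncluded : ∀ {s t n} → ascentWord s n ≡ ascentWord t n → AscentsIncluded s t (suc n)
sameAscentWord⇒ascentsIncluded {n = n} eq k 1+k<1+n sk<s1+k =
  ascentStep≡U⇒< (trans (sym (applyUpTo-cong⁻¹ n eq (s≤s⁻¹ 1+k<1+n))) (ascentStep-U sk<s1+k))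

-- The permutation realising a word

punchInℕ : ℕ → ℕ → ℕ
punchInℕ x y with y <? x
... | yes _ = y
... | no _ = suc y

punchInℕ-mono : ∀ x {y z} → y < z → punchInℕ x y < punchInℕ x z
punchInℕ-mono x {y} {z} y<z with y <? x | z <? x
... | yes _ | yes _ = y<z
... | yes _ | no _ = m<n⇒m<1+n y<z
... | no y≮x | yes z<x = contradiction (<-trans y<z z<x) y≮x
... | no _ | no _ = s≤s y<z

punchInℕ-cancel-< : ∀ x {y z} → punchInℕ x y < punchInℕ x z → y < z
punchInℕ-cancel-< x {y} {z} lt with <-cmp y z
... | tri< y<z _ _ = y<z
... | tri≈ _ refl _ = contradiction lt (<-irrefl refl)
... | tri> _ _ z<y = contradiction lt (<-asym (punchInℕ-mono x z<y))

punchInℕ-injective : ∀ x {y z} → punchInℕ x y ≡ punchInℕ x z → y ≡ z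
punchInℕ-injective x {y} {z} eq with <-cmp y z
... | tri< y<z _ _ = contradiction eq (<⇒≢ (punchInℕ-mono x y<z))
... | tri≈ _ y≡z _ = y≡z
... | tri> _ _ z<y = contradiction eq (>⇒≢ (punchInℕ-mono x z<y))

punchInℕ≢ : ∀ x y → punchInℕ x y ≢ x
punchInℕ≢ x y with y <? x
... | yes y<x = <⇒≢ y<x
... | no y≮x = λ 1+y≡x → y≮x (≤-reflexive 1+y≡x)

punchInℕ-≤ : ∀ x y → punchInℕ x y ≤ suc y
punchInℕ-≤ x y with y <? x
... | yes _ = n≤1+n y
... | no _ = ≤-refl

punchInℕ-below : ∀ {x y} → y < x → punchInℕ x y ≡ y
punchInℕ-below {x} {y} y<x with y <? x
... | yes _ = refl
... | no y≮x = contradiction y<x y≮x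

punchInℕ-self : ∀ x → punchInℕ x x ≡ suc x
punchInℕ-self x with x <? x
... | yes x<x = contradiction x<x (<-irrefl refl)
... | no _ = refl

punchInℕ-above : ∀ {x y} → x < punchInℕ x y → x ≤ y
punchInℕ-above {x} {y} x<y′ with y <? x
... | yes y<x = contradiction x<y′ (<-asym y<x)
... | no y≮x = ≮⇒≥ y≮x

ascentStep-punchInℕ : ∀ x y z → ascentStep (punchInℕ x y) (punchInℕ x z) ≡ ascentStep y z
ascentStep-punchInℕ x y z with y <? z
... | yes y<z = ascentStep-U (punchInℕ-mono x y<z)
... | no y≮z = ascentStep-D (λ lt → y≮z (punchInℕ-cancel-< x lt))

firstEntry : Step → List Step → ℕ
wordPerm : List Step → ℕ → ℕ

wordPerm [] _ = 0
wordPerm (x ∷ w) zero = firstEntry x w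
wordPerm (x ∷ w) (suc k) = punchInℕ (firstEntry x w) (wordPerm w k)

firstEntry U w = wordPerm w zero
firstEntry D w = suc (length w)

wordPerm-≤ : ∀ w {k} → k ≤ length w → wordPerm w k ≤ length w
wordPerm-≤ [] _ = z≤n
wordPerm-≤ (U ∷ w) {zero} _ = m≤n⇒m≤1+n (wordPerm-≤ w z≤n)
wordPerm-≤ (D ∷ w) {zero} _ = ≤-refl
wordPerm-≤ (x ∷ w) {suc k} 1+k≤ = ≤-trans (punchInℕ-≤ _ _) (s≤s (wordPerm-≤ w (s≤s⁻¹ 1+k≤)))

wordPerm-injective : ∀ w → InjectiveOn (wordPerm w) (suc (length w))
wordPerm-injective [] {zero} {zero} _ _ _ = refl
wordPerm-injective [] {suc _} (s≤s ()) _ _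
wordPerm-injective [] {_} {suc _} _ (s≤s ()) _
wordPerm-injective (x ∷ w) {zero} {zero} _ _ _ = refl
wordPerm-injective (x ∷ w) {zero} {suc j} _ _ eq = contradiction (sym eq) (punchInℕ≢ _ _)
wordPerm-injective (x ∷ w) {suc i} {zero} _ _ eq = contradiction eq (punchInℕ≢ _ _)
wordPerm-injective (x ∷ w) {suc i} {suc j} i< j< eq =
  cong suc (wordPerm-injective w (s≤s⁻¹ i<) (s≤s⁻¹ j<) (punchInℕ-injective _ eq))

wordPerm-firstStep : ∀ x w → stepAt (wordPerm (x ∷ w)) 0 ≡ x
wordPerm-firstStep U w = ascentStep-U (subst (wordPerm w 0 <_) (sym (punchInℕ-self _)) (n<1+n _))
wordPerm-firstStep D w =
  ascentStep-D (λ lt → <-asym lt (subst (_< suc (length w)) (sym (punchInℕ-below first<)) first<))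
  where first< = s≤s (wordPerm-≤ w z≤n)

wordPerm-ascentWord : ∀ w → ascentWord (wordPerm w) (length w) ≡ w
wordPerm-ascentWord [] = refl
wordPerm-ascentWord (x ∷ w) = cong₂ _∷_ (wordPerm-firstStep x w) (begin
  applyUpTo (λ k → stepAt (wordPerm (x ∷ w)) (suc k)) (length w)
    ≡⟨ applyUpTo-cong (length w) (λ {k} _ → ascentStep-punchInℕ _ (wordPerm w k) (wordPerm w (suc k))) ⟩
  ascentWord (wordPerm w) (length w)
    ≡⟨ wordPerm-ascentWord w ⟩
  w ∎)

wordPerm-risesAscend : ∀ w → RisesAscend (wordPerm w) (suc (length w))
wordPerm-risesAscend (x ∷ w) (suc a) (suc b) a<b b<N rise (suc k) a≤k k<b =
  punchInℕ-mono _ (wordPerm-risesAscend w a b (s≤s⁻¹ a<b) (s≤s⁻¹ b<N) (punchInℕ-cancel-< _ rise)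
                                          k (s≤s⁻¹ a≤k) (s≤s⁻¹ k<b))
wordPerm-risesAscend (D ∷ w) zero (suc b) _ b<N rise =
  contradiction rise (<-asym (subst (_< suc (length w)) (sym (punchInℕ-below tail<)) tail<))
  where tail< = s≤s (wordPerm-≤ w (s≤s⁻¹ (s≤s⁻¹ b<N)))
wordPerm-risesAscend (U ∷ w) zero (suc b) _ _ _ zero _ _ = ascentStep≡U⇒< (wordPerm-firstStep U w)
wordPerm-risesAscend (U ∷ w) zero (suc b) _ b<N rise (suc k) _ k<b =
  punchInℕ-mono _ (wordPerm-risesAscend w zero b 0<b (s≤s⁻¹ b<N) first<tail k z≤n (s≤s⁻¹ k<b))
  where
  0<b = ≤-<-trans z≤n (s≤s⁻¹ k<b)
  first<tail : wordPerm w 0 < wordPerm w b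
  first<tail =
    ≤∧≢⇒< (punchInℕ-above rise) (λ eq → <⇒≢ 0<b (wordPerm-injective w (s≤s z≤n) (s≤s⁻¹ b<N) eq))

asℕ : ∀ {N} → (Fin N → Fin N) → ℕ → ℕ
asℕ {N} f k with k <? N
... | yes k<N = toℕ (f (fromℕ< k<N))
... | no _ = 0

asℕ-fromℕ< : ∀ {N} (f : Fin N → Fin N) {k} (k<N : k < N) → asℕ f k ≡ toℕ (f (fromℕ< k<N))
asℕ-fromℕ< {N} f {k} k<N with k <? N
... | yes _ = refl
... | no k≮N = contradiction k<N k≮N

asℕ-toℕ : ∀ {N} (f : Fin N → Fin N) i → asℕ f (toℕ i) ≡ toℕ (f i)
asℕ-toℕ f i = trans (asℕ-fromℕ< f (FP.toℕ<n i)) (cong (λ j → toℕ (f j)) (FP.fromℕ<-toℕ i _))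

injective⇒surjective : ∀ {N} {f : Fin N → Fin N} → Injective _≡_ _≡_ f → ∀ v → ∃ λ i → f i ≡ v
injective⇒surjective {suc n} {f} inj v with FP.any? (λ i → f i F.≟ v)
... | yes hit = hit
... | no miss with FP.pigeonhole (n<1+n n) (λ i → F.punchOut (λ v≡fi → miss (i , sym v≡fi)))
...   | i , j , i<j , eq =
  contradiction (inj (FP.punchOut-injective (λ v≡fi → miss (i , sym v≡fi)) (λ v≡fj → miss (j , sym v≡fj)) eq))
                (FP.<⇒≢ i<j)

asℕ-permutationOn : ∀ {N} {f : Fin N → Fin N} → Injective _≡_ _≡_ f → PermutationOn (asℕ f) N
asℕ-permutationOn {N} {f} inj = record
  { injective = λ {i} {j} i<N j<N eq → begin
      i                    ≡⟨ FP.toℕ-fromℕ< i<N ⟨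
      toℕ (fromℕ< i<N)     ≡⟨ cong toℕ (inj (FP.toℕ-injective
                                (trans (sym (asℕ-fromℕ< f i<N)) (trans eq (asℕ-fromℕ< f j<N))))) ⟩
      toℕ (fromℕ< j<N)     ≡⟨ FP.toℕ-fromℕ< j<N ⟩
      j                    ∎
  ; into = λ i<N → subst (_< N) (sym (asℕ-fromℕ< f i<N)) (FP.toℕ<n _)
  ; onto = λ {v} v<N → let (i , fi≡v) = injective⇒surjective inj (fromℕ< v<N) in
      toℕ i , FP.toℕ<n i , trans (asℕ-toℕ f i) (trans (cong toℕ fi≡v) (FP.toℕ-fromℕ< v<N))
  }

vec-≡ : ∀ {N} (v v′ : Vec (Fin N) N) → EqOn (asℕ (lookup v)) (asℕ (lookup v′)) N → v ≡ v′
vec-≡ v v′ eq = begin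
  v                    ≡⟨ tabulate∘lookup v ⟨
  tabulate (lookup v)  ≡⟨ tabulate-cong (λ i → FP.toℕ-injective (begin
                            toℕ (lookup v i)        ≡⟨ asℕ-toℕ (lookup v) i ⟨
                            asℕ (lookup v) (toℕ i)  ≡⟨ eq (FP.toℕ<n i) ⟩
                            asℕ (lookup v′) (toℕ i) ≡⟨ asℕ-toℕ (lookup v′) i ⟩
                            toℕ (lookup v′ i)       ∎)) ⟩
  tabulate (lookup v′) ≡⟨ tabulate∘lookup v′ ⟩
  v′                   ∎

toVec : ∀ {N} (s : ℕ → ℕ) → .(∀ {i} → i < N → s i < N) → Vec (Fin N) N
toVec s into = tabulate (λ i → fromℕ< (into (FP.toℕ<n i)))

asℕ-toVec : ∀ {N} s .(into : ∀ {i} → i < N → s i < N) → EqOn (asℕ (lookup (toVec s into))) s N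
asℕ-toVec s into {k} k<N = begin
  asℕ (lookup (toVec s into)) k            ≡⟨ asℕ-fromℕ< _ k<N ⟩
  toℕ (lookup (toVec s into) (fromℕ< k<N)) ≡⟨ cong toℕ (lookup∘tabulate _ (fromℕ< k<N)) ⟩
  toℕ (fromℕ< (into (FP.toℕ<n (fromℕ< k<N)))) ≡⟨ FP.toℕ-fromℕ< _ ⟩
  s (toℕ (fromℕ< k<N))                     ≡⟨ cong s (FP.toℕ-fromℕ< k<N) ⟩
  s k                                      ∎

toVec-injective : ∀ {N} s .(into : ∀ {i} → i < N → s i < N) → InjectiveOn s N →
                  Injective _≡_ _≡_ (lookup (toVec s into))
toVec-injective s into inj {i} {j} eq = FP.toℕ-injective (inj (FP.toℕ<n i) (FP.toℕ<n j) (begin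
  s (toℕ i)                             ≡⟨ asℕ-toVec s into (FP.toℕ<n i) ⟨
  asℕ (lookup (toVec s into)) (toℕ i)   ≡⟨ asℕ-toℕ _ i ⟩
  toℕ (lookup (toVec s into) i)         ≡⟨ cong toℕ eq ⟩
  toℕ (lookup (toVec s into) j)         ≡⟨ asℕ-toℕ _ j ⟨
  asℕ (lookup (toVec s into)) (toℕ j)   ≡⟨ asℕ-toVec s into (FP.toℕ<n j) ⟩
  s (toℕ j)                             ∎))

triple : ℕ → ℕ → ℕ → ℕ → ℕ
triple x y z zero = x
triple x y z (suc zero) = y
triple x y z (suc (suc _)) = z

IncreasingBelow3 : (ℕ → ℕ) → Set
IncreasingBelow3 h = ∀ {p q} → p < q → q < 3 → h p < h q

triple-increasing : ∀ {x y z} → x < y → y < z → IncreasingBelow3 (triple x y z)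
triple-increasing x<y y<z {zero} {suc zero} _ _ = x<y
triple-increasing x<y y<z {zero} {suc (suc zero)} _ _ = <-trans x<y y<z
triple-increasing x<y y<z {suc zero} {suc (suc zero)} _ _ = y<z
triple-increasing x<y y<z {_} {suc (suc (suc _))} _ (s≤s (s≤s (s≤s ())))
triple-increasing x<y y<z {suc zero} {suc zero} (s≤s ()) _
triple-increasing x<y y<z {suc (suc _)} {suc zero} (s≤s ()) _
triple-increasing x<y y<z {suc (suc _)} {suc (suc zero)} (s≤s (s≤s ())) _

increasingBelow3-cancel-< : ∀ {h} → IncreasingBelow3 h → ∀ {p q} → p < 3 → h p < h q → p < q
increasingBelow3-cancel-< incr {p} {q} p<3 hp<hq with <-cmp p q
... | tri< p<q _ _ = p<q
... | tri≈ _ refl _ = contradiction hp<hq (<-irrefl refl)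
... | tri> _ _ q<p = contradiction hp<hq (<-asym (incr q<p p<3))

contains-via : ∀ {N} (σ : Perm N) (π : Perm 3) (c : Fin 3 → Fin N) → (∀ i j → i F.< j → c i F.< c j) →
               (h : ℕ → ℕ) → IncreasingBelow3 h → (∀ i → toℕ (app σ (c i)) ≡ h (toℕ (app π i))) →
               Contains σ π
contains-via σ π c c-increasing h h-increasing σc≡hπ = c , c-increasing , λ i j →
    (λ lt → increasingBelow3-cancel-< h-increasing (FP.toℕ<n (app π i)) (subst₂ _<_ (σc≡hπ i) (σc≡hπ j) lt))
  , (λ lt → subst₂ _<_ (sym (σc≡hπ i)) (sym (σc≡hπ j)) (h-increasing lt (FP.toℕ<n (app π j))))

module Positions {N a b c : ℕ} (a<b : a < b) (b<c : b < c) (c<N : c < N) where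
  b<N = <-trans b<c c<N
  a<N = <-trans a<b b<N

  position : Fin 3 → Fin N
  position F.zero = fromℕ< a<N
  position (F.suc F.zero) = fromℕ< b<N
  position (F.suc (F.suc F.zero)) = fromℕ< c<N

  toℕ-position : ∀ i → toℕ (position i) ≡ triple a b c (toℕ i)
  toℕ-position F.zero = FP.toℕ-fromℕ< a<N
  toℕ-position (F.suc F.zero) = FP.toℕ-fromℕ< b<N
  toℕ-position (F.suc (F.suc F.zero)) = FP.toℕ-fromℕ< c<N

  position-increasing : ∀ i j → i F.< j → position i F.< position j
  position-increasing i j i<j =
    subst₂ _<_ (sym (toℕ-position i)) (sym (toℕ-position j)) (triple-increasing a<b b<c i<j (FP.toℕ<n j))

  asℕ-position : ∀ {f : Fin N → Fin N} i →
                 toℕ (f (position i)) ≡ triple (asℕ f a) (asℕ f b) (asℕ f c) (toℕ i)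
  asℕ-position F.zero = sym (asℕ-fromℕ< _ a<N)
  asℕ-position (F.suc F.zero) = sym (asℕ-fromℕ< _ b<N)
  asℕ-position (F.suc (F.suc F.zero)) = sym (asℕ-fromℕ< _ c<N)

occurs132⇒contains : ∀ {N} (σ : Perm N) → Occurs132 (asℕ (app σ)) N → Contains σ p132
occurs132⇒contains σ (a , b , c , a<b , b<c , c<N , sa<sc , sc<sb) =
  contains-via σ p132 position position-increasing _ (triple-increasing sa<sc sc<sb) λ
    { F.zero → asℕ-position F.zero
    ; (F.suc F.zero) → asℕ-position (F.suc F.zero)
    ; (F.suc (F.suc F.zero)) → asℕ-position (F.suc (F.suc F.zero)) }
  where open Positions a<b b<c c<N

occurs213⇒contains : ∀ {N} (σ : Perm N) → Occurs213 (asℕ (app σ)) N → Contains σ p213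
occurs213⇒contains σ (a , b , c , a<b , b<c , c<N , sb<sa , sa<sc) =
  contains-via σ p213 position position-increasing _ (triple-increasing sb<sa sa<sc) λ
    { F.zero → asℕ-position F.zero
    ; (F.suc F.zero) → asℕ-position (F.suc F.zero)
    ; (F.suc (F.suc F.zero)) → asℕ-position (F.suc (F.suc F.zero)) }
  where open Positions a<b b<c c<N

module _ {N} (σ : Perm N) where
  private
    s = asℕ (app σ)
    0F 1F 2F : Fin 3
    0F = F.zero
    1F = F.suc F.zero
    2F = F.suc (F.suc F.zero)

  entry<⇒asℕ< : ∀ (c : Fin 3 → Fin N) {i j} → app σ (c i) F.< app σ (c j) → s (toℕ (c i)) < s (toℕ (c j))
  entry<⇒asℕ< c {i} {j} = subst₂ _<_ (sym (asℕ-toℕ (app σ) (c i))) (sym (asℕ-toℕ (app σ) (c j)))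

  contains⇒occurs132 : Contains σ p132 → Occurs132 s N
  contains⇒occurs132 (c , c-increasing , iso) =
    toℕ (c 0F) , toℕ (c 1F) , toℕ (c 2F) ,
    c-increasing 0F 1F (s≤s z≤n) , c-increasing 1F 2F (s≤s (s≤s z≤n)) , FP.toℕ<n (c 2F) ,
    entry<⇒asℕ< c (proj₂ (iso 0F 2F) (s≤s z≤n)) , entry<⇒asℕ< c (proj₂ (iso 2F 1F) (s≤s (s≤s z≤n)))

  contains⇒occurs213 : Contains σ p213 → Occurs213 s N
  contains⇒occurs213 (c , c-increasing , iso) =
    toℕ (c 0F) , toℕ (c 1F) , toℕ (c 2F) ,
    c-increasing 0F 1F (s≤s z≤n) , c-increasing 1F 2F (s≤s (s≤s z≤n)) , FP.toℕ<n (c 2F) ,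
    entry<⇒asℕ< c (proj₂ (iso 1F 0F) (s≤s z≤n)) , entry<⇒asℕ< c (proj₂ (iso 0F 2F) (s≤s (s≤s z≤n)))

indicator-< : ∀ {x y} (d : Dec (x < y)) → (if ⌊ d ⌋ then 1 else 0) ≡ countU (ascentStep x y ∷ [])
indicator-< {x} {y} d with d | x <? y
... | yes _ | yes _ = refl
... | no _ | no _ = refl
... | yes x<y | no x≮y = contradiction x<y x≮y
... | no x≮y | yes x<y = contradiction x<y x≮y

indicator-> : ∀ {x y} → x ≢ y → (d : Dec (y < x)) → (if ⌊ d ⌋ then 1 else 0) ≡ countD (ascentStep x y ∷ [])
indicator-> {x} {y} x≢y d with d | x <? y
... | yes y<x | yes x<y = contradiction x<y (<-asym y<x)
... | yes _ | no _ = refl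
... | no _ | yes _ = refl
... | no y≮x | no x≮y = contradiction (≤-antisym (≮⇒≥ y≮x) (≮⇒≥ x≮y)) x≢y

countU-++ : ∀ u v → countU (u ++ v) ≡ countU u + countU v
countU-++ [] v = refl
countU-++ (U ∷ u) v = cong suc (countU-++ u v)
countU-++ (D ∷ u) v = countU-++ u v

countD-++ : ∀ u v → countD (u ++ v) ≡ countD u + countD v
countD-++ [] v = refl
countD-++ (U ∷ u) v = countD-++ u v
countD-++ (D ∷ u) v = cong suc (countD-++ u v)

module _ {N} (σ : Perm N) where
  private
    s = asℕ (app σ)

    entry : ∀ {k} → k < N → ℕ
    entry k<N = toℕ (app σ (fromℕ< k<N))

    -- The step at i without asℕ, whose own test i < N would be caught by the
    -- `with` that unfolds ascAt and desAt.
    entryStep : ∀ {i} → suc i < N → Step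
    entryStep {i} 1+i<N = ascentStep (entry (<-trans (n<1+n i) 1+i<N)) (entry 1+i<N)

    entryStep≡stepAt : ∀ {i} (1+i<N : suc i < N) → entryStep 1+i<N ≡ stepAt s i
    entryStep≡stepAt {i} 1+i<N =
      sym (cong₂ ascentStep (asℕ-fromℕ< (app σ) (<-trans (n<1+n i) 1+i<N)) (asℕ-fromℕ< (app σ) 1+i<N))

    ascAt≡entryStep : ∀ {i} (1+i<N : suc i < N) → ascAt σ i ≡ countU (entryStep 1+i<N ∷ [])
    ascAt≡entryStep {i} 1+i<N with suc i <? N
    ... | no 1+i≮N = contradiction 1+i<N 1+i≮N
    ... | yes _ = indicator-< (app σ _ F.<? app σ _)

    desAt≡entryStep : ∀ {i} (1+i<N : suc i < N) → desAt σ i ≡ countD (entryStep 1+i<N ∷ [])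
    desAt≡entryStep {i} 1+i<N with suc i <? N
    ... | no 1+i≮N = contradiction 1+i<N 1+i≮N
    ... | yes _ = indicator-> entries≢ (app σ _ F.<? app σ _)
      where
      entries≢ : entry (<-trans (n<1+n i) 1+i<N) ≢ entry 1+i<N
      entries≢ eq = <⇒≢ (n<1+n i) (begin
        i                                       ≡⟨ FP.toℕ-fromℕ< _ ⟨
        toℕ (fromℕ< (<-trans (n<1+n i) 1+i<N))  ≡⟨ cong toℕ (proj₂ σ (FP.toℕ-injective eq)) ⟩
        toℕ (fromℕ< 1+i<N)                      ≡⟨ FP.toℕ-fromℕ< _ ⟩
        suc i                                   ∎)

  ascAt≡countU : ∀ {i} → suc i < N → ascAt σ i ≡ countU (stepAt s i ∷ [])
  ascAt≡countU 1+i<N = trans (ascAt≡entryStep 1+i<N) (cong (λ x → countU (x ∷ [])) (entryStep≡stepAt 1+i<N))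

  desAt≡countD : ∀ {i} → suc i < N → desAt σ i ≡ countD (stepAt s i ∷ [])
  desAt≡countD 1+i<N = trans (desAt≡entryStep 1+i<N) (cong (λ x → countD (x ∷ [])) (entryStep≡stepAt 1+i<N))

  ascPrefix≡countU : ∀ {p} → p < N → ascPrefix σ (suc p) ≡ countU (ascentWord s p)
  ascPrefix≡countU {zero} _ = refl
  ascPrefix≡countU {suc p} 1+p<N = begin
    ascAt σ p + ascPrefix σ (suc p)
      ≡⟨ cong₂ _+_ (ascAt≡countU 1+p<N) (ascPrefix≡countU (<-trans (n<1+n p) 1+p<N)) ⟩
    countU (stepAt s p ∷ []) + countU (ascentWord s p)
      ≡⟨ +-comm (countU (stepAt s p ∷ [])) (countU (ascentWord s p)) ⟩
    countU (ascentWord s p) + countU (stepAt s p ∷ [])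
      ≡⟨ countU-++ (ascentWord s p) _ ⟨
    countU (ascentWord s p ++ stepAt s p ∷ [])
      ≡⟨ cong countU (applyUpTo-∷ʳ (stepAt s) p) ⟩
    countU (ascentWord s (suc p)) ∎

  desPrefix≡countD : ∀ {p} → p < N → desPrefix σ (suc p) ≡ countD (ascentWord s p)
  desPrefix≡countD {zero} _ = refl
  desPrefix≡countD {suc p} 1+p<N = begin
    desAt σ p + desPrefix σ (suc p)
      ≡⟨ cong₂ _+_ (desAt≡countD 1+p<N) (desPrefix≡countD (<-trans (n<1+n p) 1+p<N)) ⟩
    countD (stepAt s p ∷ []) + countD (ascentWord s p)
      ≡⟨ +-comm (countD (stepAt s p ∷ [])) (countD (ascentWord s p)) ⟩
    countD (ascentWord s p) + countD (stepAt s p ∷ [])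
      ≡⟨ countD-++ (ascentWord s p) _ ⟨
    countD (ascentWord s p ++ stepAt s p ∷ [])
      ≡⟨ cong countD (applyUpTo-∷ʳ (stepAt s) p) ⟩
    countD (ascentWord s (suc p)) ∎

module _ {n} (σ : Perm (suc n)) where
  private
    s = asℕ (app σ)

  ballot⇒leftFactor : IsBallot σ → IsLeftFactor (ascentWord s n)
  ballot⇒leftFactor ballot u v eq =
    subst (λ u → countD u ≤ countU u) (sym u≡word)
      (subst₂ _≤_ (desPrefix≡countD σ (s≤s ∣u∣≤n)) (ascPrefix≡countU σ (s≤s ∣u∣≤n))
                  (ballot (suc (length u)) (s≤s ∣u∣≤n)))
    where
    u≡word = applyUpTo-prefix (stepAt s) n u v eq
    ∣u∣≤n : length u ≤ n
    ∣u∣≤n = subst (length u ≤_)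
              (trans (sym (length-++ u)) (trans (cong length (sym eq)) (length-applyUpTo (stepAt s) n)))
              (m≤m+n (length u) (length v))

  leftFactor⇒ballot : IsLeftFactor (ascentWord s n) → IsBallot σ
  leftFactor⇒ballot leftFactor zero _ = z≤n
  leftFactor⇒ballot leftFactor (suc q) 1+q≤1+n =
    subst₂ _≤_ (sym (desPrefix≡countD σ 1+q≤1+n)) (sym (ascPrefix≡countU σ 1+q≤1+n))
      (leftFactor (ascentWord s q) _
        (trans (cong (ascentWord s) (sym (m+[n∸m]≡n q≤n))) (applyUpTo-+ (stepAt s) q (n ∸ q))))
    where q≤n = s≤s⁻¹ 1+q≤1+n

-- The bijection between B_{n+1}(132, 213) and left factors with n steps

wordPerm-into : ∀ {n} w → length w ≡ n → ∀ {i} → i < suc n → wordPerm w i < suc n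
wordPerm-into w refl i<1+n = s≤s (wordPerm-≤ w (s≤s⁻¹ i<1+n))

wordVec : ∀ {n} w → .(length w ≡ n) → Vec (Fin (suc n)) (suc n)
wordVec w len = toVec (wordPerm w) (wordPerm-into w len)

asℕ-wordVec : ∀ {n} w (len : length w ≡ n) → EqOn (asℕ (lookup (wordVec w len))) (wordPerm w) (suc n)
asℕ-wordVec w len = asℕ-toVec (wordPerm w) (wordPerm-into w len)

wordVec-injective : ∀ {n} w (len : length w ≡ n) → Injective _≡_ _≡_ (lookup (wordVec w len))
wordVec-injective w refl = toVec-injective (wordPerm w) (wordPerm-into w refl) (wordPerm-injective w)

wordVec-risesAscend : ∀ {n} w (len : length w ≡ n) → RisesAscend (asℕ (lookup (wordVec w len))) (suc n)
wordVec-risesAscend w refl = risesAscend-cong (λ k<N → sym (asℕ-wordVec w refl k<N)) (wordPerm-risesAscend w)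

wordVec-ascentWord : ∀ {n} w (len : length w ≡ n) → ascentWord (asℕ (lookup (wordVec w len))) n ≡ w
wordVec-ascentWord w refl = trans (ascentWord-cong (asℕ-wordVec w refl)) (wordPerm-ascentWord w)

module _ (n : ℕ) where

  toLeftFactor : B-132-213 (suc n) → LeftFactor n
  toLeftFactor (v , inj , ballot , _) =
    ascentWord (asℕ (lookup v)) n , length-applyUpTo _ n , ballot⇒leftFactor (v , inj) ballot

  fromLeftFactor : LeftFactor n → B-132-213 (suc n)
  fromLeftFactor (w , len , leftFactor) =
    wordVec w len , inj , leftFactor⇒ballot σ (subst IsLeftFactor (sym (wordVec-ascentWord w len)) leftFactor) ,
    risesAscend⇒¬132 _ (wordVec-risesAscend w len) ∘ contains⇒occurs132 σ ,
    risesAscend⇒¬213 _ (wordVec-risesAscend w len) ∘ contains⇒occurs213 σ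
    where
    inj : Injective _≡_ _≡_ (lookup (wordVec w len))
    inj = wordVec-injective w len
    σ : Perm (suc n)
    σ = wordVec w len , inj

  fromLeftFactor∘toLeftFactor : ∀ a → proj₁ (fromLeftFactor (toLeftFactor a)) ≡ proj₁ a
  fromLeftFactor∘toLeftFactor (v , inj , _ , no132 , no213) = sym (vec-≡ v (wordVec W lenW)
    (risesAscend-unique (asℕ-permutationOn inj) (asℕ-permutationOn (wordVec-injective W lenW))
      rises (wordVec-risesAscend W lenW)
      (sameAscentWord⇒ascentsIncluded (sym (wordVec-ascentWord W lenW)))
      (sameAscentWord⇒ascentsIncluded (wordVec-ascentWord W lenW))))
    where
    s = asℕ (lookup v)
    W = ascentWord s n
    lenW = length-applyUpTo (stepAt s) n
    rises : RisesAscend s (suc n)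
    rises = avoiding⇒risesAscend s (PermutationOn.injective (asℕ-permutationOn inj))
              (no132 ∘ occurs132⇒contains (v , inj)) (no213 ∘ occurs213⇒contains (v , inj))

  ballotLeftFactorBij : SubsetBij (InB-132-213 (suc n)) (InLeftFactor n)
  ballotLeftFactorBij = record
    { to = toLeftFactor
    ; from = fromLeftFactor
    ; from∘to = fromLeftFactor∘toLeftFactor
    ; to∘from = λ { (w , len , _) → wordVec-ascentWord w len }
    }

-- Counting left factors

StaysNonNegative : ℕ → List Step → Set
StaysNonNegative h [] = ⊤
StaysNonNegative h (U ∷ w) = StaysNonNegative (suc h) w
StaysNonNegative zero (D ∷ w) = ⊥
StaysNonNegative (suc h) (D ∷ w) = StaysNonNegative h w

-- IsLeftFactorFrom 0 is IsLeftFactor, since 0 + n reduces to n.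
IsLeftFactorFrom : ℕ → List Step → Set
IsLeftFactorFrom h w = ∀ u v → w ≡ u ++ v → countD u ≤ h + countU u

isLeftFactorFrom⇒staysNonNegative : ∀ h w → IsLeftFactorFrom h w → StaysNonNegative h w
isLeftFactorFrom⇒staysNonNegative h [] _ = tt
isLeftFactorFrom⇒staysNonNegative h (U ∷ w) leftFactor = isLeftFactorFrom⇒staysNonNegative (suc h) w λ u v eq →
  subst (countD u ≤_) (+-suc h (countU u)) (leftFactor (U ∷ u) v (cong (U ∷_) eq))
isLeftFactorFrom⇒staysNonNegative zero (D ∷ w) leftFactor with leftFactor (D ∷ []) w refl
... | ()
isLeftFactorFrom⇒staysNonNegative (suc h) (D ∷ w) leftFactor = isLeftFactorFrom⇒staysNonNegative h w λ u v eq →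
  s≤s⁻¹ (leftFactor (D ∷ u) v (cong (D ∷_) eq))

staysNonNegative⇒isLeftFactorFrom : ∀ h w → StaysNonNegative h w → IsLeftFactorFrom h w
staysNonNegative⇒isLeftFactorFrom h w _ [] v eq = z≤n
staysNonNegative⇒isLeftFactorFrom h (U ∷ w) nonNeg (.U ∷ u) v refl =
  subst (countD u ≤_) (sym (+-suc h (countU u))) (staysNonNegative⇒isLeftFactorFrom (suc h) w nonNeg u v refl)
staysNonNegative⇒isLeftFactorFrom (suc h) (D ∷ w) nonNeg (.D ∷ u) v refl =
  s≤s (staysNonNegative⇒isLeftFactorFrom h w nonNeg u v refl)

leftFactorCount : ℕ → ℕ → ℕ
leftFactorCount h zero = 1
leftFactorCount zero (suc m) = leftFactorCount 1 m
leftFactorCount (suc h) (suc m) = leftFactorCount (suc (suc h)) m + leftFactorCount h m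

encode : ∀ h m w → .(length w ≡ m) → .(StaysNonNegative h w) → Fin (leftFactorCount h m)
encode h zero [] _ _ = F.zero
encode h zero (_ ∷ _) () _
encode h (suc m) [] () _
encode zero (suc m) (U ∷ w) len nonNeg = encode 1 m w (suc-injective len) nonNeg
encode zero (suc m) (D ∷ w) _ ()
encode (suc h) (suc m) (U ∷ w) len nonNeg = encode (suc (suc h)) m w (suc-injective len) nonNeg F.↑ˡ leftFactorCount h m
encode (suc h) (suc m) (D ∷ w) len nonNeg = leftFactorCount (suc (suc h)) m F.↑ʳ encode h m w (suc-injective len) nonNeg

decode : ∀ h m → Fin (leftFactorCount h m) → List Step
decode h zero _ = []
decode zero (suc m) i = U ∷ decode 1 m i
decode (suc h) (suc m) i =
  [ (λ j → U ∷ decode (suc (suc h)) m j) , (λ j → D ∷ decode h m j) ]′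
    (F.splitAt (leftFactorCount (suc (suc h)) m) i)

decode-length : ∀ h m i → length (decode h m i) ≡ m
decode-length h zero _ = refl
decode-length zero (suc m) i = cong suc (decode-length 1 m i)
decode-length (suc h) (suc m) i with F.splitAt (leftFactorCount (suc (suc h)) m) i
... | inj₁ j = cong suc (decode-length (suc (suc h)) m j)
... | inj₂ j = cong suc (decode-length h m j)

decode-staysNonNegative : ∀ h m i → StaysNonNegative h (decode h m i)
decode-staysNonNegative h zero _ = tt
decode-staysNonNegative zero (suc m) i = decode-staysNonNegative 1 m i
decode-staysNonNegative (suc h) (suc m) i with F.splitAt (leftFactorCount (suc (suc h)) m) i
... | inj₁ j = decode-staysNonNegative (suc (suc h)) m j
... | inj₂ j = decode-staysNonNegative h m j

encode-decode : ∀ h m i → encode h m (decode h m i) (decode-length h m i) (decode-staysNonNegative h m i) ≡ i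
encode-decode h zero F.zero = refl
encode-decode zero (suc m) i = encode-decode 1 m i
encode-decode (suc h) (suc m) i with F.splitAt (leftFactorCount (suc (suc h)) m) i in eq
... | inj₁ j = trans (cong (F._↑ˡ leftFactorCount h m) (encode-decode (suc (suc h)) m j)) (FP.splitAt⁻¹-↑ˡ eq)
... | inj₂ j = trans (cong (leftFactorCount (suc (suc h)) m F.↑ʳ_) (encode-decode h m j)) (FP.splitAt⁻¹-↑ʳ eq)

decode-encode : ∀ h m w (len : length w ≡ m) (nonNeg : StaysNonNegative h w) →
                decode h m (encode h m w len nonNeg) ≡ w
decode-encode h zero [] _ _ = refl
decode-encode zero (suc m) (U ∷ w) len nonNeg = cong (U ∷_) (decode-encode 1 m w (suc-injective len) nonNeg)
decode-encode (suc h) (suc m) (U ∷ w) len nonNeg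
  rewrite FP.splitAt-↑ˡ (leftFactorCount (suc (suc h)) m) (encode (suc (suc h)) m w (suc-injective len) nonNeg)
                        (leftFactorCount h m)
  = cong (U ∷_) (decode-encode (suc (suc h)) m w (suc-injective len) nonNeg)
decode-encode (suc h) (suc m) (D ∷ w) len nonNeg
  rewrite FP.splitAt-↑ʳ (leftFactorCount (suc (suc h)) m) (leftFactorCount h m) (encode h m w (suc-injective len) nonNeg)
  = cong (D ∷_) (decode-encode h m w (suc-injective len) nonNeg)

leftFactorBij : ∀ n → SubsetBij (InLeftFactor n) (λ (_ : Fin (leftFactorCount 0 n)) → ⊤)
leftFactorBij n = record
  { to = λ { (w , len , leftFactor) → encode 0 n w len (isLeftFactorFrom⇒staysNonNegative 0 w leftFactor) , tt }
  ; from = λ { (i , _) → decode 0 n i , decode-length 0 n i ,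
                          staysNonNegative⇒isLeftFactorFrom 0 _ (decode-staysNonNegative 0 n i) }
  ; from∘to = λ { (w , len , leftFactor) →
                  decode-encode 0 n w len (isLeftFactorFrom⇒staysNonNegative 0 w leftFactor) }
  ; to∘from = λ { (i , _) → encode-decode 0 n i }
  }

binomialSum : ℕ → ℕ → ℕ
binomialSum m zero = 0
binomialSum m (suc k) = binomialSum m k + m C k

binomialSum-zero : ∀ k → binomialSum 0 (suc k) ≡ 1
binomialSum-zero zero = refl
binomialSum-zero (suc k) = trans (+-identityʳ _) (binomialSum-zero k)

binomialSum-pascal : ∀ m k → binomialSum (suc m) (suc k) ≡ binomialSum m (suc k) + binomialSum m k
binomialSum-pascal m zero = refl
binomialSum-pascal m (suc k) = begin
  binomialSum (suc m) (suc k) + suc m C suc k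
    ≡⟨ cong₂ _+_ (binomialSum-pascal m k) (sym (nCk+nC[k+1]≡[n+1]C[k+1] m k)) ⟩
  (binomialSum m (suc k) + binomialSum m k) + (m C k + m C suc k)
    ≡⟨ cong (binomialSum m (suc k) + binomialSum m k +_) (+-comm (m C k) (m C suc k)) ⟩
  (binomialSum m (suc k) + binomialSum m k) + (m C suc k + m C k)
    ≡⟨ interchange (binomialSum m (suc k)) (binomialSum m k) (m C suc k) (m C k) ⟩
  binomialSum m (suc (suc k)) + binomialSum m (suc k) ∎

binomialSum-suc : ∀ m k → binomialSum (suc m) k ≡ binomialSum m (k ∸ 1) + binomialSum m k
binomialSum-suc m zero = refl
binomialSum-suc m (suc k) = trans (binomialSum-pascal m k) (+-comm (binomialSum m (suc k)) (binomialSum m k))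

⌊m∸[2+h]/2⌋≡⌊m∸h/2⌋∸1 : ∀ m h → ⌊ m ∸ (2 + h) /2⌋ ≡ ⌊ m ∸ h /2⌋ ∸ 1
⌊m∸[2+h]/2⌋≡⌊m∸h/2⌋∸1 zero zero = refl
⌊m∸[2+h]/2⌋≡⌊m∸h/2⌋∸1 zero (suc h) = refl
⌊m∸[2+h]/2⌋≡⌊m∸h/2⌋∸1 (suc zero) zero = refl
⌊m∸[2+h]/2⌋≡⌊m∸h/2⌋∸1 (suc (suc m)) zero = refl
⌊m∸[2+h]/2⌋≡⌊m∸h/2⌋∸1 (suc m) (suc h) = ⌊m∸[2+h]/2⌋≡⌊m∸h/2⌋∸1 m h

leftFactorCount-binomialSum : ∀ h m →
  leftFactorCount h m + binomialSum m ⌊ m ∸ h /2⌋ ≡ binomialSum m (suc ⌊ h + m /2⌋)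
leftFactorCount-binomialSum zero zero = refl
leftFactorCount-binomialSum (suc h) zero = sym (binomialSum-zero ⌊ suc h + 0 /2⌋)
leftFactorCount-binomialSum zero (suc m) = begin
  leftFactorCount 1 m + binomialSum (suc m) a
    ≡⟨ cong (leftFactorCount 1 m +_) (binomialSum-suc m a) ⟩
  leftFactorCount 1 m + (binomialSum m (a ∸ 1) + binomialSum m a)
    ≡⟨ +-assoc (leftFactorCount 1 m) (binomialSum m (a ∸ 1)) (binomialSum m a) ⟨
  leftFactorCount 1 m + binomialSum m (a ∸ 1) + binomialSum m a
    ≡⟨ cong (λ i → leftFactorCount 1 m + binomialSum m i + binomialSum m a)
            (⌊m∸[2+h]/2⌋≡⌊m∸h/2⌋∸1 (suc m) 0) ⟨
  leftFactorCount 1 m + binomialSum m ⌊ m ∸ 1 /2⌋ + binomialSum m a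
    ≡⟨ cong (_+ binomialSum m a) (leftFactorCount-binomialSum 1 m) ⟩
  binomialSum m (suc a) + binomialSum m a
    ≡⟨ binomialSum-pascal m a ⟨
  binomialSum (suc m) (suc a) ∎
  where a = ⌊ suc m /2⌋
leftFactorCount-binomialSum (suc h) (suc m) = begin
  (c₂ + c₀) + binomialSum (suc m) a
    ≡⟨ cong (c₂ + c₀ +_) (binomialSum-suc m a) ⟩
  (c₂ + c₀) + (binomialSum m (a ∸ 1) + binomialSum m a)
    ≡⟨ interchange c₂ c₀ (binomialSum m (a ∸ 1)) (binomialSum m a) ⟩
  (c₂ + binomialSum m (a ∸ 1)) + (c₀ + binomialSum m a)
    ≡⟨ cong (λ i → c₂ + binomialSum m i + (c₀ + binomialSum m a)) (⌊m∸[2+h]/2⌋≡⌊m∸h/2⌋∸1 m h) ⟨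
  (c₂ + binomialSum m ⌊ m ∸ (2 + h) /2⌋) + (c₀ + binomialSum m a)
    ≡⟨ cong₂ _+_ (leftFactorCount-binomialSum (suc (suc h)) m) (leftFactorCount-binomialSum h m) ⟩
  binomialSum m (suc (suc b)) + binomialSum m (suc b)
    ≡⟨ binomialSum-pascal m (suc b) ⟨
  binomialSum (suc m) (suc (suc b))
    ≡⟨ cong (λ i → binomialSum (suc m) (suc ⌊ suc i /2⌋)) (+-suc h m) ⟨
  binomialSum (suc m) (suc ⌊ suc h + suc m /2⌋) ∎
  where
  a = ⌊ m ∸ h /2⌋
  b = ⌊ h + m /2⌋
  c₂ = leftFactorCount (suc (suc h)) m
  c₀ = leftFactorCount h m

leftFactorCount-central : ∀ n → leftFactorCount 0 n ≡ n C ⌊ n /2⌋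
leftFactorCount-central n = +-cancelʳ-≡ (binomialSum n ⌊ n /2⌋) (leftFactorCount 0 n) (n C ⌊ n /2⌋)
  (trans (leftFactorCount-binomialSum 0 n) (+-comm (binomialSum n ⌊ n /2⌋) (n C ⌊ n /2⌋)))

⌊n/2⌋≡n/2 : ∀ n → ⌊ n /2⌋ ≡ n / 2
⌊n/2⌋≡n/2 zero = refl
⌊n/2⌋≡n/2 (suc zero) = refl
⌊n/2⌋≡n/2 (suc (suc n)) =
  trans (cong suc (⌊n/2⌋≡n/2 n)) (sym (m/n≡1+[m∸n]/n {suc (suc n)} {2} (s≤s (s≤s z≤n))))

-- Composing needs the inner maps to ignore the membership proofs.
subsetBij-trans : ∀ {X Y Z : Set} {P : X → Set} {Q : Y → Set} {R : Z → Set} →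
                  (f : SubsetBij P Q) (g : SubsetBij Q R) →
                  (∀ b b′ → proj₁ b ≡ proj₁ b′ → proj₁ (SubsetBij.from f b) ≡ proj₁ (SubsetBij.from f b′)) →
                  (∀ b b′ → proj₁ b ≡ proj₁ b′ → proj₁ (SubsetBij.to g b) ≡ proj₁ (SubsetBij.to g b′)) →
                  SubsetBij P R
subsetBij-trans f g from-cong to-cong = record
  { to = Bg.to ∘ Bf.to
  ; from = Bf.from ∘ Bg.from
  ; from∘to = λ a → trans (from-cong _ _ (Bg.from∘to (Bf.to a))) (Bf.from∘to a)
  ; to∘from = λ c → trans (to-cong _ _ (Bf.to∘from (Bg.from c))) (Bg.to∘from c)
  }
  where
  module Bf = SubsetBij f
  module Bg = SubsetBij g

theorem3p7 : ((n : ℕ) → SubsetBij (InB-132-213 (suc n)) (InLeftFactor n))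
    × ((n : ℕ) → SubsetBij (InB-132-213 (suc n)) (λ (_ : Fin (n C (n / 2))) → ⊤))
theorem3p7 = ballotLeftFactorBij , λ n →
  subst (λ m → SubsetBij (InB-132-213 (suc n)) (λ (_ : Fin m) → ⊤))
    (trans (leftFactorCount-central n) (cong (n C_) (⌊n/2⌋≡n/2 n)))
    (subsetBij-trans (ballotLeftFactorBij n) (leftFactorBij n)
      (λ { (w , _) (.w , _) refl → refl })
      (λ { (w , _) (.w , _) refl → refl }))
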